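{- Let $m \geq 3$, let $H = \Theta(l_1,\ldots,l_m)$ with $l_1 = \cdots = l_m = 4$, and let $G = H^2$. Then $G$ is equitably $(m+2)$-choosable.
   Context: $\Theta(l_1,\ldots,l_m)$ ($l_1\le\cdots\le l_m$) denotes a generalized theta graph: two vertices $u,w$ joined by $m$ internally disjoint paths of lengths $l_1,\ldots,l_m$. $H^2$ is the square of $H$ (two vertices adjacent iff at distance at most 2 in $H$). A $k$-assignment $L$ assigns to each vertex a list of exactly $k$ colors; an equitable $L$-coloring of $G$ is a proper coloring $f$ with $f(v)\in L(v)$ using each color at most $\lceil |V(G)|/k\rceil$ times; $G$ is equitably $k$-choosable if it has an equitable $L$-coloring for every $k$-assignment $L$. -}

module Defs where

open import Data.Nat using (ℕ; zero; suc; _+_; _∸_; _≤_; pred)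
open import Data.Nat.DivMod using (_/_)
open import Data.Fin using (Fin; toℕ)
open import Data.List using (List; []; _∷_; allFin; length; filter; map; concatMap; _++_)
open import Data.List.Membership.Propositional using (_∈_)
open import Data.List.Relation.Unary.Unique.Propositional using (Unique)
open import Data.Fin using () renaming (zero to fz)
open import Data.List using () renaming ([] to nil)
open import Data.Product using (Σ; _×_)
open import Data.Sum using (_⊎_)
open import Relation.Nullary using (¬_)
open import Relation.Binary.PropositionalEquality using (_≡_)
import Data.Fin as F
import Data.Nat as N

record FinGraph : Set₁ where
  field
    V    : Set
    allV : List V             -- enumeration of V (each vertex once)
    Adj  : V → V → Set

open FinGraph public

∣V∣ : FinGraph → ℕ
∣V∣ G = length (allV G)

-- Generalized theta graph Θ(l₁,…,lₘ): vertices u, w and, on path i,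
-- internal vertices int i j (j = 0 … lᵢ-2, i.e. position j+1 on the path).

data ThV (m : ℕ) (l : Fin m → ℕ) : Set where
  u w : ThV m l
  int : (i : Fin m) → Fin (pred (l i)) → ThV m l

data ThEdge (m : ℕ) (l : Fin m → ℕ) : ThV m l → ThV m l → Set where
  e-uw  : (i : Fin m) → l i ≡ 1 → ThEdge m l u w
  e-u   : (i : Fin m) (j : Fin (pred (l i))) → toℕ j ≡ 0 → ThEdge m l u (int i j)
  e-mid : (i : Fin m) (j j′ : Fin (pred (l i))) → suc (toℕ j) ≡ toℕ j′ →
          ThEdge m l (int i j) (int i j′)
  e-w   : (i : Fin m) (j : Fin (pred (l i))) → suc (toℕ j) ≡ pred (l i) →
          ThEdge m l (int i j) w

Theta : (m : ℕ) → (Fin m → ℕ) → FinGraph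
Theta m l = record
  { V    = ThV m l
  ; allV = u ∷ w ∷ concatMap (λ i → map (int i) (allFin (pred (l i)))) (allFin m)
  ; Adj  = λ x y → ThEdge m l x y ⊎ ThEdge m l y x
  }

Square : FinGraph → FinGraph
Square G = record
  { V    = V G
  ; allV = allV G
  ; Adj  = λ x y → ¬ (x ≡ y) × (Adj G x y ⊎ Σ (V G) (λ z → Adj G x z × Adj G z y))
  }

IsKAssignment : (G : FinGraph) → ℕ → (V G → List ℕ) → Set
IsKAssignment G k L = (v : V G) → length (L v) ≡ k × Unique (L v)

colourCount : (G : FinGraph) → (V G → ℕ) → ℕ → ℕ
colourCount G f c = length (filter (λ v → f v N.≟ c) (allV G))

-- ⌈ n / k ⌉  (k = 0 never used: a 0-assignment admits no colouring here)
ceilDiv : ℕ → ℕ → ℕ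
ceilDiv n zero    = 0
ceilDiv n (suc k) = (n + k) / suc k

IsEquitableLColouring : (G : FinGraph) (k : ℕ) (L : V G → List ℕ) → (V G → ℕ) → Set
IsEquitableLColouring G k L f =
  ((v : V G) → f v ∈ L v) ×
  ((x y : V G) → Adj G x y → ¬ (f x ≡ f y)) ×
  ((c : ℕ) → colourCount G f c ≤ ceilDiv (∣V∣ G) k)

EquitablyChoosable : FinGraph → ℕ → Set
EquitablyChoosable G k =
  (L : V G → List ℕ) → IsKAssignment G k L →
  Σ (V G → ℕ) (λ f → IsEquitableLColouring G k L f)

module Submission where

-- Write path i of Θ = Θ(4,…,4) as u – a i – b i – c i – w.  In Θ² the sets
-- {u} ∪ {a i} and {w} ∪ {c i} are cliques; the other edges are u – b i,
-- b i – w and the triangles a i b i c i.  We build an L-colouring that is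
-- proper and moreover rainbow on the b i (a "good" palette).  Such a colouring
-- uses each colour at most once in each of the classes {u, a i}, {w, c i},
-- {b i}, hence at most 3 = ⌈(3m+2)/(m+2)⌉ times: it is equitable.

open import Defs
open import Data.Nat using (ℕ; zero; suc; _≤_; _<_; _+_; _*_; z≤n; s≤s; _≟_)
open import Data.Nat.Properties
  using (module ≤-Reasoning; ≤-refl; ≤-trans; ≤-reflexive; <⇒≱; +-comm; +-suc; +-mono-≤; +-monoˡ-≤; m≤m+n; m≤n+m; m<m+n)
open import Data.Fin using (Fin) renaming (zero to fz; suc to fs)
open import Data.Fin.Properties using (injective⇒≤; suc-injective)
open import Data.Nat.Solver using (module +-*-Solver)
open import Data.Nat.DivMod using (_/_; m*n/n≡m; /-monoˡ-≤)
open import Data.List using (List; []; _∷_; _++_; length; lookup; tabulate; filter; map; concatMap; allFin)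
open import Data.List.Properties using (length-++; length-tabulate; filter-++; filter-accept; filter-reject; filter-none)
open import Data.List.Membership.Propositional using (_∈_; _∉_; find; lose)
open import Data.List.Membership.Propositional.Properties using (∈-lookup; ∈-++⁺ˡ; ∈-++⁺ʳ; ∈-++⁻; ∈-tabulate⁺)
open import Data.List.Membership.DecPropositional _≟_ using (_∈?_)
import Data.List.Membership.Setoid.Properties as SetoidMembership
open import Data.List.Relation.Unary.Any as Any using (Any; here; there; any?)
import Data.List.Relation.Unary.All as All
open import Data.List.Relation.Unary.AllPairs using (AllPairs; []; _∷_)
open import Data.List.Relation.Unary.AllPairs.Properties using (tabulate⁺)
open import Data.List.Relation.Unary.Unique.Propositional using (Unique)
import Data.List.Relation.Unary.Unique.Propositional.Properties as Unique
open import Data.Vec.Functional using (toList) renaming (_∷_ to _◂_)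
open import Data.Product using (Σ; _,_; proj₁; proj₂)
open import Data.Sum using (_⊎_; inj₁; inj₂; [_,_]′)
open import Data.Empty using (⊥-elim)
open import Relation.Nullary using (¬_; yes; no; ¬?)
open import Relation.Nullary.Decidable using (decidable-stable)
open import Relation.Binary.PropositionalEquality using (_≡_; _≢_; refl; sym; trans; cong; cong₂; subst; setoid; ≢-sym; module ≡-Reasoning)
open import Function using (_∘_)

lookup-injective : ∀ {A : Set} {xs : List A} → Unique xs →
                   ∀ i j → lookup xs i ≡ lookup xs j → i ≡ j
lookup-injective (_ ∷ _)    fz     fz     _  = refl
lookup-injective (x≢ ∷ _)   fz     (fs j) eq = ⊥-elim (All.lookup x≢ (∈-lookup j) eq)
lookup-injective (x≢ ∷ _)   (fs i) fz     eq = ⊥-elim (All.lookup x≢ (∈-lookup i) (sym eq))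
lookup-injective (_ ∷ uniq) (fs i) (fs j) eq = cong fs (lookup-injective uniq i j eq)

unique-⊆⇒length≤ : ∀ {A : Set} {xs ys : List A} → Unique xs →
                   (∀ {z} → z ∈ xs → z ∈ ys) → length xs ≤ length ys
unique-⊆⇒length≤ {xs = xs} {ys} uniq xs⊆ys = injective⇒≤ position-injective
  where
  position : Fin (length xs) → Fin (length ys)
  position i = Any.index (xs⊆ys (∈-lookup i))

  position-injective : ∀ {i j} → position i ≡ position j → i ≡ j
  position-injective {i} {j} eq = lookup-injective uniq i j
    (SetoidMembership.index-injective (setoid _) (xs⊆ys (∈-lookup i)) (xs⊆ys (∈-lookup j)) eq)

none-outside⇒⊆ : ∀ {L F : List ℕ} → ¬ Any (_∉ F) L → ∀ {z} → z ∈ L → z ∈ F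
none-outside⇒⊆ {F = F} none {z} z∈L = decidable-stable (z ∈? F) (λ z∉F → none (lose z∈L z∉F))

record Choice (L F : List ℕ) : Set where
  field
    colour  : ℕ
    allowed : colour ∈ L
    fresh   : colour ∉ F

  avoids : ∀ {x} → x ∈ F → colour ≢ x
  avoids x∈F refl = fresh x∈F

choose : ∀ {L : List ℕ} (F : List ℕ) → Unique L → length F < length L → Choice L F
choose {L} F uniq short with any? (λ x → ¬? (x ∈? F)) L
... | yes outside = let x , x∈L , x∉F = find outside in record { colour = x ; allowed = x∈L ; fresh = x∉F }
... | no none = ⊥-elim (<⇒≱ short (unique-⊆⇒length≤ uniq (none-outside⇒⊆ none)))

avoid-more : ∀ {L F F′ : List ℕ} → Choice L F → (∀ {z} → z ∈ F′ → z ∈ F ⊎ z ∉ L) → Choice L F′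
avoid-more {L} {F′ = F′} c F′-harmless = record { colour = colour ; allowed = allowed ; fresh = fresh′ }
  where
  open Choice c
  fresh′ : colour ∉ F′
  fresh′ x∈F′ = [ fresh , (λ x∉L → x∉L allowed) ]′ (F′-harmless x∈F′)

-- A second forbidden colour y′ next to y comes for free when y and y′
-- coincide or one of them is not in L: only |F| + 1 < |L| is needed.
choose-spare : ∀ {L : List ℕ} (y y′ : ℕ) (F : List ℕ) → Unique L →
               length (y ∷ F) < length L → y ∉ L ⊎ y′ ∉ L ⊎ y ≡ y′ →
               Choice L (y ∷ y′ ∷ F)
choose-spare y y′ F uniq short (inj₁ y∉L) = avoid-more (choose (y′ ∷ F) uniq short)
  λ { (here refl) → inj₂ y∉L ; (there z∈) → inj₁ z∈ }
choose-spare y y′ F uniq short (inj₂ (inj₁ y′∉L)) = avoid-more (choose (y ∷ F) uniq short)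
  λ { (here refl) → inj₁ (here refl) ; (there (here refl)) → inj₂ y′∉L ; (there (there z∈)) → inj₁ (there z∈) }
choose-spare y .y F uniq short (inj₂ (inj₂ refl)) = avoid-more (choose (y ∷ F) uniq short)
  λ { (here refl) → inj₁ (here refl) ; (there (here refl)) → inj₁ (here refl) ; (there (there z∈)) → inj₁ (there z∈) }

element : ∀ {A : Set} {xs : List A} → 0 < length xs → Σ A (_∈ xs)
element {xs = x ∷ _} _ = x , here refl

record SparePair (L₀ L₁ L₂ : List ℕ) : Set where
  field
    β γ   : ℕ
    β∈L₁  : β ∈ L₁
    γ∈L₂  : γ ∈ L₂
    spare : β ∉ L₀ ⊎ γ ∉ L₀ ⊎ β ≡ γ

-- If L₁, L₂ are non-empty, duplicate-free and together longer than L₀, such a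
-- pair exists: otherwise L₁ and L₂ are disjoint subsets of L₀.
spare-pair : ∀ {L₀ L₁ L₂ : List ℕ} → Unique L₁ → Unique L₂ → 0 < length L₁ → 0 < length L₂ →
             length L₀ < length L₁ + length L₂ → SparePair L₀ L₁ L₂
spare-pair {L₀} {L₁} {L₂} uniq₁ uniq₂ nonempty₁ nonempty₂ long
  with any? (λ x → ¬? (x ∈? L₀)) L₁ | any? (λ x → ¬? (x ∈? L₀)) L₂ | any? (_∈? L₂) L₁
... | yes outside₁ | _ | _ =
  let β , β∈ , β∉ = find outside₁ ; γ , γ∈ = element nonempty₂
  in record { β = β ; γ = γ ; β∈L₁ = β∈ ; γ∈L₂ = γ∈ ; spare = inj₁ β∉ }
... | no _ | yes outside₂ | _ =
  let γ , γ∈ , γ∉ = find outside₂ ; β , β∈ = element nonempty₁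
  in record { β = β ; γ = γ ; β∈L₁ = β∈ ; γ∈L₂ = γ∈ ; spare = inj₂ (inj₁ γ∉) }
... | no _ | no _ | yes common =
  let x , x∈L₁ , x∈L₂ = find common
  in record { β = x ; γ = x ; β∈L₁ = x∈L₁ ; γ∈L₂ = x∈L₂ ; spare = inj₂ (inj₂ refl) }
... | no inside₁ | no inside₂ | no disjoint = ⊥-elim (<⇒≱ long (≤-trans (≤-reflexive (sym (length-++ L₁))) too-long))
  where
  too-long : length (L₁ ++ L₂) ≤ length L₀
  too-long = unique-⊆⇒length≤ (Unique.++⁺ uniq₁ uniq₂ (λ (x∈L₁ , x∈L₂) → disjoint (lose x∈L₁ x∈L₂)))
    λ x∈ → [ none-outside⇒⊆ inside₁ , none-outside⇒⊆ inside₂ ]′ (∈-++⁻ L₁ x∈)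

Rainbow : ∀ {k} → (Fin k → ℕ) → Set
Rainbow {k} col = ∀ (i j : Fin k) → i ≢ j → col i ≢ col j

rainbow-◂ : ∀ {k x} {col : Fin k → ℕ} → (∀ j → x ≢ col j) → Rainbow col → Rainbow (x ◂ col)
rainbow-◂ new old fz     fz     i≢j = ⊥-elim (i≢j refl)
rainbow-◂ new old fz     (fs j) _   = new j
rainbow-◂ new old (fs i) fz     _   = λ eq → new i (sym eq)
rainbow-◂ new old (fs i) (fs j) i≢j = old i j (λ eq → i≢j (cong fs eq))

≢-◂ : ∀ {k y x} {col : Fin k → ℕ} → y ≢ x → (∀ j → y ≢ col j) → ∀ j → y ≢ (x ◂ col) j
≢-◂ y≢x _     fz     = y≢x
≢-◂ _   y≢col (fs j) = y≢col j

∉-toList : ∀ {k x} {col : Fin k → ℕ} → x ∉ toList col → ∀ j → x ≢ col j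
∉-toList x∉ j refl = x∉ (∈-tabulate⁺ j)

record RainbowChoice (k : ℕ) (Lx ext : Fin k → List ℕ) (base : List ℕ) : Set where
  field
    col        : Fin k → ℕ
    allowed    : ∀ j → col j ∈ Lx j
    fresh-ext  : ∀ j → col j ∉ ext j
    fresh-base : ∀ j → col j ∉ base
    rainbow    : Rainbow col

  avoids-ext : ∀ j {x} → x ∈ ext j → col j ≢ x
  avoids-ext j x∈ refl = fresh-ext j x∈

  avoids-base : ∀ j {x} → x ∈ base → col j ≢ x
  avoids-base j x∈ refl = fresh-base j x∈

choose-rainbow : ∀ k (Lx ext : Fin k → List ℕ) (base : List ℕ) → (∀ j → Unique (Lx j)) →
                 (∀ j → length (ext j) + length base + k ≤ length (Lx j)) →
                 RainbowChoice k Lx ext base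
choose-rainbow zero Lx ext base _ _ = record
  { col = λ () ; allowed = λ () ; fresh-ext = λ () ; fresh-base = λ () ; rainbow = λ () }
choose-rainbow (suc k) Lx ext base uniq room = record
  { col        = First.colour ◂ Rest.col
  ; allowed    = λ { fz → First.allowed ; (fs j) → Rest.allowed j }
  ; fresh-ext  = λ { fz → λ x∈ → First.fresh (∈-++⁺ˡ x∈) ; (fs j) → Rest.fresh-ext j }
  ; fresh-base = λ { fz → λ x∈ → First.fresh (∈-++⁺ʳ (ext fz) x∈) ; (fs j) → λ x∈ → Rest.fresh-base j (there x∈) }
  ; rainbow    = rainbow-◂ (λ j eq → Rest.fresh-base j (here (sym eq))) Rest.rainbow
  }
  where
  -- Colouring vertex 0 moves one unit of room from k to the base list.
  shift : ∀ e b → e + b + suc k ≡ e + suc b + k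
  shift e b = trans (+-suc (e + b) k) (cong (_+ k) (sym (+-suc e b)))

  first-room : length (ext fz ++ base) < length (Lx fz)
  first-room = begin-strict
    length (ext fz ++ base)               ≡⟨ length-++ (ext fz) ⟩
    length (ext fz) + length base         <⟨ m<m+n _ (s≤s z≤n) ⟩
    length (ext fz) + length base + suc k ≤⟨ room fz ⟩
    length (Lx fz)                        ∎
    where open ≤-Reasoning

  module First = Choice (choose (ext fz ++ base) (uniq fz) first-room)
  module Rest = RainbowChoice (choose-rainbow k (λ j → Lx (fs j)) (λ j → ext (fs j))
                  (First.colour ∷ base) (λ j → uniq (fs j))
                  (λ j → ≤-trans (≤-reflexive (sym (shift _ _))) (room (fs j))))

Θ₄ : ℕ → FinGraph
Θ₄ m = Theta m (λ _ → 4)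

Vtx : ℕ → Set
Vtx m = ThV m (λ _ → 4)

a b c : ∀ {m} → Fin m → Vtx m
a i = int i fz
b i = int i (fs fz)
c i = int i (fs (fs fz))

data PathEdge {m : ℕ} : Vtx m → Vtx m → Set where
  u-a : ∀ i → PathEdge u (a i)
  a-b : ∀ i → PathEdge (a i) (b i)
  b-c : ∀ i → PathEdge (b i) (c i)
  c-w : ∀ i → PathEdge (c i) w

path-edge : ∀ {m} {p q : Vtx m} → ThEdge m (λ _ → 4) p q → PathEdge p q
path-edge (e-uw i ())
path-edge (e-u i fz refl)                    = u-a i
path-edge (e-mid i fz (fs fz) refl)          = a-b i
path-edge (e-mid i (fs fz) (fs (fs fz)) refl) = b-c i
path-edge (e-w i (fs (fs fz)) refl)          = c-w i

data Close {m : ℕ} : Vtx m → Vtx m → Set where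
  edge : ∀ {p q} → PathEdge p q → Close p q
  u-b  : ∀ i → Close u (b i)
  b-w  : ∀ i → Close (b i) w
  a-c  : ∀ i → Close (a i) (c i)
  a-a  : ∀ i j → i ≢ j → Close (a i) (a j)
  c-c  : ∀ i j → i ≢ j → Close (c i) (c j)

two-step : ∀ {m} {p r q : Vtx m} → p ≢ q → PathEdge p r ⊎ PathEdge r p → PathEdge r q ⊎ PathEdge q r →
           Close p q ⊎ Close q p
two-step _   (inj₁ (u-a i)) (inj₁ (a-b .i)) = inj₁ (u-b i)
two-step p≢q (inj₁ (u-a i)) (inj₂ (u-a .i)) = ⊥-elim (p≢q refl)
two-step _   (inj₁ (a-b i)) (inj₁ (b-c .i)) = inj₁ (a-c i)
two-step p≢q (inj₁ (a-b i)) (inj₂ (a-b .i)) = ⊥-elim (p≢q refl)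
two-step _   (inj₁ (b-c i)) (inj₁ (c-w .i)) = inj₁ (b-w i)
two-step p≢q (inj₁ (b-c i)) (inj₂ (b-c .i)) = ⊥-elim (p≢q refl)
two-step p≢q (inj₁ (c-w i)) (inj₂ (c-w j))  = inj₁ (c-c i j (λ i≡j → p≢q (cong c i≡j)))
two-step p≢q (inj₂ (u-a i)) (inj₁ (u-a j))  = inj₁ (a-a i j (λ i≡j → p≢q (cong a i≡j)))
two-step p≢q (inj₂ (a-b i)) (inj₁ (a-b .i)) = ⊥-elim (p≢q refl)
two-step _   (inj₂ (a-b i)) (inj₂ (u-a .i)) = inj₂ (u-b i)
two-step p≢q (inj₂ (b-c i)) (inj₁ (b-c .i)) = ⊥-elim (p≢q refl)
two-step _   (inj₂ (b-c i)) (inj₂ (a-b .i)) = inj₂ (a-c i)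
two-step p≢q (inj₂ (c-w i)) (inj₁ (c-w .i)) = ⊥-elim (p≢q refl)
two-step _   (inj₂ (c-w i)) (inj₂ (b-c .i)) = inj₂ (b-w i)

square-close : ∀ {m} {p q : Vtx m} → Adj (Square (Θ₄ m)) p q → Close p q ⊎ Close q p
square-close (_ , inj₁ (inj₁ e))        = inj₁ (edge (path-edge e))
square-close (_ , inj₁ (inj₂ e))        = inj₂ (edge (path-edge e))
square-close (p≢q , inj₂ (_ , e₁ , e₂)) = two-step p≢q (orient e₁) (orient e₂)
  where
  orient : ∀ {p q} → ThEdge _ (λ _ → 4) p q ⊎ ThEdge _ (λ _ → 4) q p → PathEdge p q ⊎ PathEdge q p
  orient (inj₁ e) = inj₁ (path-edge e)
  orient (inj₂ e) = inj₂ (path-edge e)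

record Palette (m : ℕ) : Set where
  field
    col-u col-w       : ℕ
    col-a col-b col-c : Fin m → ℕ

paint : ∀ {m} → Palette m → Vtx m → ℕ
paint P u                    = Palette.col-u P
paint P w                    = Palette.col-w P
paint P (int i fz)           = Palette.col-a P i
paint P (int i (fs fz))      = Palette.col-b P i
paint P (int i (fs (fs fz))) = Palette.col-c P i

record Good {m : ℕ} (P : Palette m) : Set where
  open Palette P
  field
    rainbow-ua : Rainbow (col-u ◂ col-a)
    rainbow-wc : Rainbow (col-w ◂ col-c)
    rainbow-b  : Rainbow col-b
    u≢b : ∀ i → col-u ≢ col-b i
    b≢w : ∀ i → col-b i ≢ col-w
    a≢b : ∀ i → col-a i ≢ col-b i
    b≢c : ∀ i → col-b i ≢ col-c i
    a≢c : ∀ i → col-a i ≢ col-c i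

good-separates : ∀ {m} {P : Palette m} → Good P → ∀ {p q} → Close p q → paint P p ≢ paint P q
good-separates G (edge (u-a i)) = Good.rainbow-ua G fz (fs i) (λ ())
good-separates G (edge (a-b i)) = Good.a≢b G i
good-separates G (edge (b-c i)) = Good.b≢c G i
good-separates G (edge (c-w i)) = Good.rainbow-wc G (fs i) fz (λ ())
good-separates G (u-b i)        = Good.u≢b G i
good-separates G (b-w i)        = Good.b≢w G i
good-separates G (a-c i)        = Good.a≢c G i
good-separates G (a-a i j i≢j)  = Good.rainbow-ua G (fs i) (fs j) (λ eq → i≢j (suc-injective eq))
good-separates G (c-c i j i≢j)  = Good.rainbow-wc G (fs i) (fs j) (λ eq → i≢j (suc-injective eq))

good⇒proper : ∀ {m} {P : Palette m} → Good P →
              (p q : Vtx m) → Adj (Square (Θ₄ m)) p q → paint P p ≢ paint P q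
good⇒proper G p q adj with square-close adj
... | inj₁ close = good-separates G close
... | inj₂ close = λ eq → good-separates G close (sym eq)

occurrences : ∀ {A : Set} → (A → ℕ) → ℕ → List A → ℕ
occurrences f k xs = length (filter (λ v → f v ≟ k) xs)

occurrences-++ : ∀ {A : Set} (f : A → ℕ) k (xs ys : List A) →
                 occurrences f k (xs ++ ys) ≡ occurrences f k xs + occurrences f k ys
occurrences-++ f k xs ys =
  trans (cong length (filter-++ (λ v → f v ≟ k) xs ys)) (length-++ (filter (λ v → f v ≟ k) xs))

occurrences-distinct : ∀ {A : Set} (f : A → ℕ) k (xs : List A) →
                       AllPairs (λ v v′ → f v ≢ f v′) xs → occurrences f k xs ≤ 1
occurrences-distinct f k []       []              = z≤n
occurrences-distinct f k (x ∷ xs) (x-fresh ∷ rest) with f x ≟ k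
... | yes refl = ≤-reflexive (begin
  occurrences f (f x) (x ∷ xs) ≡⟨ cong length (filter-accept (λ v → f v ≟ f x) refl) ⟩
  suc (occurrences f (f x) xs)  ≡⟨ cong (λ l → suc (length l)) (filter-none (λ v → f v ≟ f x) (All.map (λ fx≢fv fv≡fx → fx≢fv (sym fv≡fx)) x-fresh)) ⟩
  1                             ∎)
  where open ≡-Reasoning
... | no fx≢k = ≤-trans (≤-reflexive (cong length (filter-reject (λ v → f v ≟ k) fx≢k))) (occurrences-distinct f k xs rest)

occurrences-∷ : ∀ {A : Set} (f : A → ℕ) k (x : A) (xs : List A) →
                occurrences f k (x ∷ xs) ≡ occurrences f k (x ∷ []) + occurrences f k xs
occurrences-∷ f k x xs = occurrences-++ f k (x ∷ []) xs

occurrences-paths : ∀ {M} (f : Vtx M → ℕ) k {m} (g : Fin m → Fin M) →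
  occurrences f k (concatMap (λ i → map (int i) (allFin 3)) (tabulate g)) ≡
  occurrences f k (tabulate (λ i → a (g i))) + occurrences f k (tabulate (λ i → b (g i)))
    + occurrences f k (tabulate (λ i → c (g i)))
occurrences-paths f k {zero}  g = refl
occurrences-paths f k {suc m} g = begin
  # (a i ∷ b i ∷ c i ∷ rest)               ≡⟨ peel ⟩
  #a + (#b + (#c + # rest))                ≡⟨ cong (λ t → #a + (#b + (#c + t))) (occurrences-paths f k (g ∘ fs)) ⟩
  #a + (#b + (#c + (# as + # bs + # cs)))  ≡⟨ regroup #a #b #c (# as) (# bs) (# cs) ⟩
  (#a + # as) + (#b + # bs) + (#c + # cs)  ≡⟨ sym (cong₂ _+_ (cong₂ _+_ (split (a i) as) (split (b i) bs)) (split (c i) cs)) ⟩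
  # (a i ∷ as) + # (b i ∷ bs) + # (c i ∷ cs) ∎
  where
  open ≡-Reasoning
  open +-*-Solver
  # : List (Vtx _) → ℕ
  # = occurrences f k
  split : ∀ v vs → # (v ∷ vs) ≡ # (v ∷ []) + # vs
  split = occurrences-∷ f k
  i : Fin _
  i = g fz
  #a #b #c : ℕ
  #a = # (a i ∷ [])
  #b = # (b i ∷ [])
  #c = # (c i ∷ [])
  rest as bs cs : List (Vtx _)
  rest = concatMap (λ i → map (int i) (allFin 3)) (tabulate (g ∘ fs))
  as = tabulate (a ∘ g ∘ fs)
  bs = tabulate (b ∘ g ∘ fs)
  cs = tabulate (c ∘ g ∘ fs)
  peel : # (a i ∷ b i ∷ c i ∷ rest) ≡ #a + (#b + (#c + # rest))
  peel = trans (split _ _) (cong (#a +_) (trans (split _ _) (cong (#b +_) (split _ _))))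
  regroup : ∀ x y z X Y Z → x + (y + (z + (X + Y + Z))) ≡ (x + X) + (y + Y) + (z + Z)
  regroup = solve 6 (λ x y z X Y Z → x :+ (y :+ (z :+ (X :+ Y :+ Z))) := (x :+ X) :+ (y :+ Y) :+ (z :+ Z)) refl

occurrences-rainbow : ∀ {A : Set} (f : A → ℕ) k {n} (g : Fin n → A) →
                      Rainbow (λ i → f (g i)) → occurrences f k (tabulate g) ≤ 1
occurrences-rainbow f k g rainbow =
  occurrences-distinct f k (tabulate g) (tabulate⁺ (λ {i} {j} → rainbow i j))

rainbow-resp : ∀ {n} {col col′ : Fin n → ℕ} → (∀ i → col i ≡ col′ i) → Rainbow col → Rainbow col′
rainbow-resp same rainbow i j i≢j eq = rainbow i j i≢j (trans (same i) (trans eq (sym (same j))))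

occurrences-classes : ∀ {m} (f : Vtx m → ℕ) k →
  occurrences f k (allV (Θ₄ m)) ≡
  occurrences f k (tabulate (u ◂ a)) + occurrences f k (tabulate (w ◂ c)) + occurrences f k (tabulate b)
occurrences-classes {m} f k = begin
  # (u ∷ w ∷ paths)                              ≡⟨ peel ⟩
  #u + (#w + # paths)                            ≡⟨ cong (λ t → #u + (#w + t)) (occurrences-paths f k (λ i → i)) ⟩
  #u + (#w + (# (tabulate a) + # (tabulate b) + # (tabulate c)))
    ≡⟨ regroup #u #w (# (tabulate a)) (# (tabulate b)) (# (tabulate c)) ⟩
  (#u + # (tabulate a)) + (#w + # (tabulate c)) + # (tabulate b)
    ≡⟨ sym (cong₂ (λ s t → s + t + # (tabulate b)) (split u (tabulate a)) (split w (tabulate c))) ⟩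
  # (tabulate (u ◂ a)) + # (tabulate (w ◂ c)) + # (tabulate b) ∎
  where
  open ≡-Reasoning
  open +-*-Solver
  # : List (Vtx m) → ℕ
  # = occurrences f k
  split : ∀ v vs → # (v ∷ vs) ≡ # (v ∷ []) + # vs
  split = occurrences-∷ f k
  #u #w : ℕ
  #u = # (u ∷ [])
  #w = # (w ∷ [])
  paths : List (Vtx m)
  paths = concatMap (λ i → map (int i) (allFin 3)) (allFin m)
  peel : # (u ∷ w ∷ paths) ≡ #u + (#w + # paths)
  peel = trans (split _ _) (cong (#u +_) (split _ _))
  regroup : ∀ x y A B C → x + (y + (A + B + C)) ≡ (x + A) + (y + C) + B
  regroup = solve 5 (λ x y A B C → x :+ (y :+ (A :+ B :+ C)) := (x :+ A) :+ (y :+ C) :+ B) refl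

good⇒at-most-three : ∀ {m} {P : Palette m} → Good P → ∀ k → colourCount (Square (Θ₄ m)) (paint P) k ≤ 3
good⇒at-most-three {m} {P} G k = begin
  occurrences (paint P) k (allV (Θ₄ m))        ≡⟨ occurrences-classes (paint P) k ⟩
  # (tabulate (u ◂ a)) + # (tabulate (w ◂ c)) + # (tabulate b)
    ≤⟨ +-mono-≤ (+-mono-≤ (occurrences-rainbow (paint P) k (u ◂ a) (rainbow-resp (λ { fz → refl ; (fs i) → refl }) rainbow-ua))
                          (occurrences-rainbow (paint P) k (w ◂ c) (rainbow-resp (λ { fz → refl ; (fs i) → refl }) rainbow-wc)))
                (occurrences-rainbow (paint P) k b rainbow-b) ⟩
  3                                            ∎
  where
  open Good G
  open ≤-Reasoning
  # : List (Vtx m) → ℕ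
  # = occurrences (paint P) k

vertex-count : ∀ m → ∣V∣ (Θ₄ m) ≡ 2 + m * 3
vertex-count m = cong (λ t → 2 + t) (trans (paths-length (allFin m)) (cong (_* 3) (length-tabulate {n = m} (λ i → i))))
  where
  paths-length : (is : List (Fin m)) → length (concatMap (λ i → map (int i) (allFin 3)) is) ≡ length is * 3
  paths-length []       = refl
  paths-length (_ ∷ is) = cong (λ t → 3 + t) (paths-length is)

≤-ceilDiv : ∀ q n k → q * suc k ≤ n + k → q ≤ ceilDiv n (suc k)
≤-ceilDiv q n k q[k+1]≤n+k = begin
  q                     ≡⟨ sym (m*n/n≡m q (suc k)) ⟩
  q * suc k / suc k     ≤⟨ /-monoˡ-≤ (suc k) q[k+1]≤n+k ⟩
  (n + k) / suc k       ∎
  where open ≤-Reasoning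

three≤ceil : ∀ n → 3 ≤ ceilDiv (∣V∣ (Θ₄ (3 + n))) (3 + n + 2)
three≤ceil n = subst (λ N → 3 ≤ ceilDiv N (3 + n + 2)) (sym (vertex-count (3 + n)))
  (≤-ceilDiv 3 (2 + (3 + n) * 3) (2 + (n + 2)) (≤-trans (m≤m+n _ n) (≤-reflexive (identity n))))
  where
  open +-*-Solver
  identity : ∀ n → 3 * (3 + (n + 2)) + n ≡ 2 + (3 + n) * 3 + (2 + (n + 2))
  identity = solve 1 (λ n → con 3 :* (con 3 :+ (n :+ con 2)) :+ n := con 2 :+ (con 3 :+ n) :* con 3 :+ (con 2 :+ (n :+ con 2))) refl

-- Paths p₀, p₁ are coloured by hand, the ordinary paths
-- greedily; the colour of c p₀ is chosen last and needs the spare pair.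
module Construction (n : ℕ) (L : Vtx (3 + n) → List ℕ)
                    (isK : IsKAssignment (Square (Θ₄ (3 + n))) (3 + n + 2) L) where

  uniq : ∀ v → Unique (L v)
  uniq v = proj₂ (isK v)

  capacity : ∀ v → length (L v) ≡ 5 + n
  capacity v = trans (proj₁ (isK v)) (+-comm (3 + n) 2)

  fits : ∀ v (F : List ℕ) → length F ≤ 4 + n → length F < length (L v)
  fits v F short = subst (length F <_) (sym (capacity v)) (s≤s short)

  choose-within : ∀ v (F : List ℕ) → length F ≤ 4 + n → Choice (L v) F
  choose-within v F short = choose F (uniq v) (fits v F short)

  room : ∀ v {j} → j ≤ 5 + n → j ≤ length (L v)
  room v {j} j≤ = subst (j ≤_) (sym (capacity v)) j≤

  nonempty : ∀ v → 0 < length (L v)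
  nonempty v = fits v [] z≤n

  with-ordinary : ∀ (F : List ℕ) (col : Fin (suc n) → ℕ) → length F ≤ 3 → length (F ++ toList col) ≤ 4 + n
  with-ordinary F col F≤3 = begin
    length (F ++ toList col)          ≡⟨ length-++ F ⟩
    length F + length (toList col)    ≡⟨ cong (length F +_) (length-tabulate col) ⟩
    length F + suc n                  ≤⟨ +-monoˡ-≤ (suc n) F≤3 ⟩
    4 + n                             ∎
    where open ≤-Reasoning

  p₀ p₁ : Fin (3 + n)
  p₀ = fz
  p₁ = fs fz

  ordinary : Fin (suc n) → Fin (3 + n)
  ordinary k = fs (fs k)

  pair-room : length (L (c p₀)) < length (L (c p₁)) + length (L (b p₀))
  pair-room = begin-strict
    length (L (c p₀))                         ≡⟨ capacity (c p₀) ⟩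
    5 + n                                     <⟨ m<m+n (5 + n) (s≤s z≤n) ⟩
    (5 + n) + (5 + n)                         ≡⟨ sym (cong₂ _+_ (capacity (c p₁)) (capacity (b p₀))) ⟩
    length (L (c p₁)) + length (L (b p₀))     ∎
    where open ≤-Reasoning

  -- β colours c p₁ and γ colours b p₀; they coincide or one misses L (c p₀).
  pair : SparePair (L (c p₀)) (L (c p₁)) (L (b p₀))
  pair = spare-pair (uniq _) (uniq _) (nonempty _) (nonempty _) pair-room

  module Pair = SparePair pair
  open Pair using (β; γ)

  b₁ : Choice (L (b p₁)) (β ∷ γ ∷ [])
  b₁ = choose-within (b p₁) _ (s≤s (s≤s z≤n))
  module B₁ = Choice b₁

  b-ordinary : RainbowChoice (suc n) (λ k → L (b (ordinary k))) (λ _ → []) (γ ∷ B₁.colour ∷ [])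
  b-ordinary = choose-rainbow (suc n) _ _ _ (λ _ → uniq _) (λ _ → room _ (m≤n+m (3 + n) 2))
  module Bs = RainbowChoice b-ordinary

  col-b : Fin (3 + n) → ℕ
  col-b = γ ◂ B₁.colour ◂ Bs.col

  u-choice : Choice (L u) (toList col-b)
  u-choice = choose-within u _ (with-ordinary (γ ∷ B₁.colour ∷ []) Bs.col (s≤s (s≤s z≤n)))
  module U = Choice u-choice

  a₁ : Choice (L (a p₁)) (U.colour ∷ B₁.colour ∷ β ∷ [])
  a₁ = choose-within (a p₁) _ (s≤s (s≤s (s≤s z≤n)))
  module A₁ = Choice a₁

  a-ordinary : RainbowChoice (suc n) (λ k → L (a (ordinary k))) (λ k → Bs.col k ∷ []) (U.colour ∷ A₁.colour ∷ [])
  a-ordinary = choose-rainbow (suc n) _ _ _ (λ _ → uniq _) (λ _ → room _ (m≤n+m (4 + n) 1))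
  module As = RainbowChoice a-ordinary

  a₀ : Choice (L (a p₀)) (γ ∷ U.colour ∷ toList (A₁.colour ◂ As.col))
  a₀ = choose-within (a p₀) _ (with-ordinary (γ ∷ U.colour ∷ A₁.colour ∷ []) As.col ≤-refl)
  module A₀ = Choice a₀

  col-a : Fin (3 + n) → ℕ
  col-a = A₀.colour ◂ A₁.colour ◂ As.col

  w-choice : Choice (L w) (β ∷ toList col-b)
  w-choice = choose-within w _ (with-ordinary (β ∷ γ ∷ B₁.colour ∷ []) Bs.col ≤-refl)
  module W = Choice w-choice

  -- The c-vertices: the ordinary ones greedily, then c p₀.  The latter must avoid
  -- m + 2 colours (β, γ, ω, the colour of a p₀ and m − 2 ordinary c-colours),
  -- as many as its list holds; the spare pair makes one of them free.
  c-ordinary : RainbowChoice (suc n) (λ k → L (c (ordinary k))) (λ k → As.col k ∷ Bs.col k ∷ []) (β ∷ W.colour ∷ [])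
  c-ordinary = choose-rainbow (suc n) _ _ _ (λ _ → uniq _) (λ _ → room _ ≤-refl)
  module Cs = RainbowChoice c-ordinary

  c₀ : Choice (L (c p₀)) (β ∷ γ ∷ W.colour ∷ A₀.colour ∷ toList Cs.col)
  c₀ = choose-spare β γ (W.colour ∷ A₀.colour ∷ toList Cs.col) (uniq (c p₀))
         (fits (c p₀) (β ∷ W.colour ∷ A₀.colour ∷ toList Cs.col)
           (with-ordinary (β ∷ W.colour ∷ A₀.colour ∷ []) Cs.col ≤-refl)) Pair.spare
  module C₀ = Choice c₀

  col-c : Fin (3 + n) → ℕ
  col-c = C₀.colour ◂ β ◂ Cs.col

  palette : Palette (3 + n)
  palette = record { col-u = U.colour ; col-w = W.colour ; col-a = col-a ; col-b = col-b ; col-c = col-c }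

  allowed : ∀ v → paint palette v ∈ L v
  allowed u                               = U.allowed
  allowed w                               = W.allowed
  allowed (int fz fz)                     = A₀.allowed
  allowed (int (fs fz) fz)                = A₁.allowed
  allowed (int (fs (fs k)) fz)            = As.allowed k
  allowed (int fz (fs fz))                = Pair.γ∈L₂
  allowed (int (fs fz) (fs fz))           = B₁.allowed
  allowed (int (fs (fs k)) (fs fz))       = Bs.allowed k
  allowed (int fz (fs (fs fz)))           = C₀.allowed
  allowed (int (fs fz) (fs (fs fz)))      = Pair.β∈L₁
  allowed (int (fs (fs k)) (fs (fs fz)))  = Cs.allowed k

  rainbow-ua : Rainbow (U.colour ◂ col-a)
  rainbow-ua = rainbow-◂ u-new (rainbow-◂ a₀-new (rainbow-◂ a₁-new As.rainbow))
    where
    a₁-new : ∀ k → A₁.colour ≢ As.col k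
    a₁-new k = ≢-sym (As.avoids-base k (there (here refl)))
    a₀-new : ∀ j → A₀.colour ≢ (A₁.colour ◂ As.col) j
    a₀-new = ∉-toList {col = A₁.colour ◂ As.col} (A₀.fresh ∘ there ∘ there)
    u-new : ∀ j → U.colour ≢ col-a j
    u-new = ≢-◂ (≢-sym (A₀.avoids (there (here refl))))
              (≢-◂ (≢-sym (A₁.avoids (here refl))) (λ k → ≢-sym (As.avoids-base k (here refl))))

  rainbow-wc : Rainbow (W.colour ◂ col-c)
  rainbow-wc = rainbow-◂ w-new (rainbow-◂ c₀-new (rainbow-◂ β-new Cs.rainbow))
    where
    β-new : ∀ k → β ≢ Cs.col k
    β-new k = ≢-sym (Cs.avoids-base k (here refl))
    c₀-new : ∀ j → C₀.colour ≢ (β ◂ Cs.col) j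
    c₀-new = ≢-◂ (C₀.avoids (here refl)) (∉-toList {col = Cs.col} (C₀.fresh ∘ there ∘ there ∘ there ∘ there))
    w-new : ∀ j → W.colour ≢ col-c j
    w-new = ≢-◂ (≢-sym (C₀.avoids (there (there (here refl)))))
              (≢-◂ (W.avoids (here refl)) (λ k → ≢-sym (Cs.avoids-base k (there (here refl)))))

  rainbow-b : Rainbow col-b
  rainbow-b = rainbow-◂ γ-new (rainbow-◂ b₁-new Bs.rainbow)
    where
    b₁-new : ∀ k → B₁.colour ≢ Bs.col k
    b₁-new k = ≢-sym (Bs.avoids-base k (there (here refl)))
    γ-new : ∀ j → γ ≢ (B₁.colour ◂ Bs.col) j
    γ-new = ≢-◂ (≢-sym (B₁.avoids (there (here refl)))) (λ k → ≢-sym (Bs.avoids-base k (here refl)))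

  a≢b : ∀ i → col-a i ≢ col-b i
  a≢b fz          = A₀.avoids (here refl)
  a≢b (fs fz)     = A₁.avoids (there (here refl))
  a≢b (fs (fs k)) = As.avoids-ext k (here refl)

  b≢c : ∀ i → col-b i ≢ col-c i
  b≢c fz          = ≢-sym (C₀.avoids (there (here refl)))
  b≢c (fs fz)     = B₁.avoids (here refl)
  b≢c (fs (fs k)) = ≢-sym (Cs.avoids-ext k (there (here refl)))

  a≢c : ∀ i → col-a i ≢ col-c i
  a≢c fz          = ≢-sym (C₀.avoids (there (there (there (here refl)))))
  a≢c (fs fz)     = A₁.avoids (there (there (here refl)))
  a≢c (fs (fs k)) = ≢-sym (Cs.avoids-ext k (here refl))

  good : Good palette
  good = record
    { rainbow-ua = rainbow-ua
    ; rainbow-wc = rainbow-wc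
    ; rainbow-b  = rainbow-b
    ; u≢b        = ∉-toList {col = col-b} U.fresh
    ; b≢w        = λ i → ≢-sym (∉-toList {col = col-b} (W.fresh ∘ there) i)
    ; a≢b        = a≢b
    ; b≢c        = b≢c
    ; a≢c        = a≢c
    }

lemma3p8 : (m : ℕ) → 3 ≤ m →
    EquitablyChoosable (Square (Theta m (λ (_ : Fin m) → 4))) (m + 2)
lemma3p8 (suc (suc (suc n))) (s≤s (s≤s (s≤s z≤n))) L isK =
  paint palette , allowed , good⇒proper good , λ k → ≤-trans (good⇒at-most-three good k) (three≤ceil n)
  where open Construction n L isK
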